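{- Let $x$ be an almost periodic sequence over a finite alphabet. Then $x$ is effectively almost periodic if and only if $x$ is computable and the set $\mathrm{Fac}(x)$ of its factors is decidable.
   Context: A sequence over a finite alphabet $A$ is a map $x\colon\mathbb{N}\to A$; $x[i,j]=x(i)\dots x(j)$, $x[i,\infty)$ is the suffix from $i$. $\mathrm{Fac}(x)$ is the set of nonempty finite words occurring in $x$ (factors). $x$ is almost periodic if for each factor $u$ there is $l$ such that every segment of $x$ of length $l$ contains an occurrence of $u$. $x$ is generalized almost periodic if the same holds for every factor occurring infinitely often. The regulator $r_x(n)$ of a generalized almost periodic $x$ is the least $l$ such that every length-$n$ word occurring infinitely often in $x$ occurs in every length-$l$ segment of $x$, and every length-$n$ word occurring only finitely often does not occur in $x[l,\infty)$. $x$ is effectively almost periodic if it is almost periodic, computable, and some computable function $f$ satisfies $f(n)\ge r_x(n)$ for all $n$. -}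

module Defs where

open import Data.Nat using (ℕ; zero; suc; _+_; _*_; _≤_; _<_)
open import Data.Fin using (Fin; toℕ)
open import Data.Vec using (Vec; []; _∷_)
open import Data.List using (List; []; _∷_; length)
open import Data.Product using (Σ; ∃; _×_; _,_)
open import Data.Sum using (_⊎_)
open import Relation.Nullary using (¬_)
open import Relation.Binary.PropositionalEquality using (_≡_; _≢_)

data Code : ℕ → Set where
  zer  : ∀ {n} → Code n
  succ : Code 1
  proj : ∀ {n} → Fin n → Code n
  comp : ∀ {m n} → Code m → Vec (Code n) m → Code n
  prec : ∀ {n} → Code n → Code (suc (suc n)) → Code (suc n)
  mu   : ∀ {n} → Code (suc n) → Code n

lookupV : ∀ {n} → Vec ℕ n → Fin n → ℕ
lookupV (a ∷ as) Fin.zero    = a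
lookupV (a ∷ as) (Fin.suc i) = lookupV as i

mutual
  data _[_]⇓_ : ∀ {n} → Code n → Vec ℕ n → ℕ → Set where
    ev-zer  : ∀ {n} {xs : Vec ℕ n} → zer [ xs ]⇓ 0
    ev-succ : ∀ {a} → succ [ a ∷ [] ]⇓ suc a
    ev-proj : ∀ {n} {xs : Vec ℕ n} (i : Fin n) → proj i [ xs ]⇓ lookupV xs i
    ev-comp : ∀ {m n} {f : Code m} {gs : Vec (Code n) m} {xs : Vec ℕ n} {ys : Vec ℕ m} {y : ℕ} →
              gs [ xs ]⇓* ys → f [ ys ]⇓ y → comp f gs [ xs ]⇓ y
    ev-prec-zero : ∀ {n} {g : Code n} {h : Code (suc (suc n))} {xs : Vec ℕ n} {y : ℕ} →
              g [ xs ]⇓ y → prec g h [ 0 ∷ xs ]⇓ y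
    ev-prec-suc : ∀ {n} {g : Code n} {h : Code (suc (suc n))} {xs : Vec ℕ n} {k r y : ℕ} →
              prec g h [ k ∷ xs ]⇓ r → h [ r ∷ k ∷ xs ]⇓ y → prec g h [ suc k ∷ xs ]⇓ y
    ev-mu   : ∀ {n} {f : Code (suc n)} {xs : Vec ℕ n} {y : ℕ} →
              f [ y ∷ xs ]⇓ 0 →
              (∀ z → z < y → Σ ℕ λ v → f [ z ∷ xs ]⇓ suc v) →
              mu f [ xs ]⇓ y

  data _[_]⇓*_ : ∀ {m n} → Vec (Code n) m → Vec ℕ n → Vec ℕ m → Set where
    ev-[] : ∀ {n} {xs : Vec ℕ n} → [] [ xs ]⇓* []
    ev-∷  : ∀ {m n} {g : Code n} {gs : Vec (Code n) m} {xs : Vec ℕ n} {y : ℕ} {ys : Vec ℕ m} →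
            g [ xs ]⇓ y → gs [ xs ]⇓* ys → (g ∷ gs) [ xs ]⇓* (y ∷ ys)

ComputableFun : (ℕ → ℕ) → Set
ComputableFun f = Σ (Code 1) λ e → ∀ n → e [ n ∷ [] ]⇓ f n

Seq : ℕ → Set
Seq k = ℕ → Fin k

Word : ℕ → Set
Word k = List (Fin k)

-- Standard bijective-style coding of words by natural numbers (base k+1, digits 1..k).
encode : ∀ {k} → Word k → ℕ
encode {k} []      = 0
encode {k} (a ∷ w) = suc (toℕ a) + suc k * encode w

ComputableSeq : ∀ {k} → Seq k → Set
ComputableSeq x = ComputableFun (λ n → toℕ (x n))

DecidableSet : ∀ {k} → (Word k → Set) → Set
DecidableSet {k} P = Σ (Code 1) λ e → ∀ (w : Word k) →
  (P w × e [ encode w ∷ [] ]⇓ 1) ⊎ (¬ P w × e [ encode w ∷ [] ]⇓ 0)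

OccursAt : ∀ {k} → Seq k → Word k → ℕ → Set
OccursAt x []      i = Data.Unit.⊤ where import Data.Unit
OccursAt x (a ∷ u) i = (x i ≡ a) × OccursAt x u (suc i)

Fac : ∀ {k} → Seq k → Word k → Set
Fac x u = (u ≢ []) × (Σ ℕ λ i → OccursAt x u i)

OccursInSegment : ∀ {k} → Seq k → Word k → (i l : ℕ) → Set
OccursInSegment x u i l = Σ ℕ λ j → (i ≤ j) × (j + length u ≤ i + l) × OccursAt x u j

InEverySegment : ∀ {k} → Seq k → Word k → ℕ → Set
InEverySegment x u l = ∀ i → OccursInSegment x u i l

AlmostPeriodic : ∀ {k} → Seq k → Set
AlmostPeriodic x = ∀ u → Fac x u → Σ ℕ λ l → InEverySegment x u l

InfinitelyOften : ∀ {k} → Seq k → Word k → Set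
InfinitelyOften x u = ∀ m → Σ ℕ λ j → (m ≤ j) × OccursAt x u j

FinitelyOften : ∀ {k} → Seq k → Word k → Set
FinitelyOften x u = Fac x u × ¬ InfinitelyOften x u

-- l satisfies the defining condition of the regulator at n.
-- r_x(n) is the least such l; since the condition is upward closed in l,
-- "l ≥ r_x(n)" is exactly "RegulatorCondition x n l".
RegulatorCondition : ∀ {k} → Seq k → ℕ → ℕ → Set
RegulatorCondition x n l =
  (∀ u → length u ≡ n → Fac x u → InfinitelyOften x u → InEverySegment x u l) ×
  (∀ u → length u ≡ n → FinitelyOften x u → ∀ j → l ≤ j → ¬ OccursAt x u j)

EffectivelyAlmostPeriodic : ∀ {k} → Seq k → Set
EffectivelyAlmostPeriodic x =
  AlmostPeriodic x × ComputableSeq x ×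
  (Σ (ℕ → ℕ) λ f → ComputableFun f × (∀ n → RegulatorCondition x n (f n)))

module Submission where

-- Words are coded in base k+1 (WordCoding): the
-- code of a word of length L is below (k+1)ᴸ and its digits are computable, so
-- quantifying over all words of length L is a bounded quantifier over codes.
--   (⇒) A factor w occurs in the initial segment of length f(|w|), f a computable
--       bound on the regulator, so Fac(x) is a bounded search (Forward).
--   (⇐) "Every factor of length n occurs in every segment of length L" is decidable
--       with the help of the decider for Fac(x); almost periodicity and the
--       finiteness of the set of words of length n guarantee such an L, so the
--       least one is found by unbounded search and bounds the regulator (Backward).

open import Defs
open import Data.Nat using (ℕ; zero; suc; _+_; _*_; _∸_; _≤_; _<_; _⊔_; z≤n; s≤s; z<s; pred; _/_; _%_; _<?_)
open import Data.Nat.Properties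
open import Data.Nat.DivMod using ([m+kn]%n≡m%n; m<n⇒m%n≡m; +-distrib-/-∣ʳ; m<n⇒m/n≡0; m*n/n≡m; 0/n≡0)
open import Data.Nat.DivMod using (m%n<n; m≡m%n+[m/n]*n)
open import Data.Nat.Divisibility using (divides)
open import Data.Fin using (Fin; toℕ; fromℕ<) renaming (zero to fz; suc to fs)
open import Data.Fin.Properties using (toℕ-injective; toℕ-fromℕ<; toℕ<n)
open import Data.Vec using (Vec; []; _∷_; tabulate; tail)
open import Data.List using ([]; _∷_; length; drop)
open import Data.Product using (Σ; _×_; _,_; proj₁; proj₂)
open import Data.Sum using (_⊎_; inj₁; inj₂; [_,_]′)
open import Data.Empty using (⊥-elim)
open import Function using (_∘_)
open import Function.Bundles using (_⇔_; mk⇔; Equivalence)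
open import Relation.Nullary using (¬_; Dec; yes; no)
open import Relation.Binary.PropositionalEquality
open Equivalence using (to; from)

Computable : (n : ℕ) → (Vec ℕ n → ℕ) → Set
Computable n F = Σ (Code n) λ e → ∀ xs → e [ xs ]⇓ F xs

Computable₂ : (ℕ → ℕ → ℕ) → Set
Computable₂ f = Σ (Code 2) λ e → ∀ a c → e [ a ∷ c ∷ [] ]⇓ f a c

primRec : ℕ → (ℕ → ℕ → ℕ) → ℕ → ℕ
primRec z s zero    = z
primRec z s (suc k) = s (primRec z s k) k

projections : ∀ {m n} → (Fin m → Fin n) → Vec (Code n) m
projections {zero}  σ = []
projections {suc m} σ = proj (σ fz) ∷ projections (λ i → σ (fs i))

projections-⇓ : ∀ {m n} (σ : Fin m → Fin n) (xs : Vec ℕ n) →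
  projections σ [ xs ]⇓* tabulate (λ i → lookupV xs (σ i))
projections-⇓ {zero}  σ xs = ev-[]
projections-⇓ {suc m} σ xs = ev-∷ (ev-proj (σ fz)) (projections-⇓ (λ i → σ (fs i)) xs)

tabulate-lookupV : ∀ {n} (xs : Vec ℕ n) → tabulate (lookupV xs) ≡ xs
tabulate-lookupV []       = refl
tabulate-lookupV (x ∷ xs) = cong (x ∷_) (tabulate-lookupV xs)

identity-⇓ : ∀ {n} (xs : Vec ℕ n) → projections (λ i → i) [ xs ]⇓* xs
identity-⇓ xs = subst (projections (λ i → i) [ xs ]⇓*_) (tabulate-lookupV xs) (projections-⇓ (λ i → i) xs)

tail-⇓ : ∀ {n} (y : ℕ) (xs : Vec ℕ n) → projections fs [ y ∷ xs ]⇓* xs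
tail-⇓ y xs = subst (projections fs [ y ∷ xs ]⇓*_) (tabulate-lookupV xs) (projections-⇓ fs (y ∷ xs))

sucᶜ : ∀ {n F} → Computable n F → Computable n (λ xs → suc (F xs))
sucᶜ (e , p) = comp succ (e ∷ []) , λ xs → ev-comp (ev-∷ (p xs) ev-[]) ev-succ

constᶜ : ∀ {n} a → Computable n (λ _ → a)
constᶜ zero    = zer , λ _ → ev-zer
constᶜ (suc a) = sucᶜ (constᶜ a)

varᶜ : ∀ {n} (i : Fin n) → Computable n (λ xs → lookupV xs i)
varᶜ i = proj i , λ _ → ev-proj i

#0 : ∀ {n} → Computable (suc n) (λ xs → lookupV xs fz)
#0 = varᶜ fz

#1 : ∀ {n} → Computable (suc (suc n)) (λ xs → lookupV xs (fs fz))
#1 = varᶜ (fs fz)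

apply₁ : ∀ {n f G} → ComputableFun f → Computable n G → Computable n (λ xs → f (G xs))
apply₁ (f , pf) (e , p) = comp f (e ∷ []) , λ xs → ev-comp (ev-∷ (p xs) ev-[]) (pf _)

apply₂ : ∀ {n f G H} → Computable₂ f → Computable n G → Computable n H →
  Computable n (λ xs → f (G xs) (H xs))
apply₂ (f , pf) (e , p) (e' , p') =
  comp f (e ∷ e' ∷ []) , λ xs → ev-comp (ev-∷ (p xs) (ev-∷ (p' xs) ev-[])) (pf _ _)

weaken : ∀ {n F} → Computable n F → Computable (suc n) (λ xs → F (tail xs))
weaken (e , p) = comp e (projections fs) , λ { (y ∷ xs) → ev-comp (tail-⇓ y xs) (p xs) }

recᶜ : ∀ {n T Z S} → Computable n T → Computable n Z → Computable (suc (suc n)) S →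
  Computable n (λ xs → primRec (Z xs) (λ r j → S (r ∷ j ∷ xs)) (T xs))
recᶜ {T = T} {Z} {S} (t , pt) (z , pz) (s , ps) =
  comp (prec z s) (t ∷ projections (λ i → i)) , λ xs → ev-comp (ev-∷ (pt xs) (identity-⇓ xs)) (iterate xs (T xs))
  where
  iterate : ∀ xs k → prec z s [ k ∷ xs ]⇓ primRec (Z xs) (λ r j → S (r ∷ j ∷ xs)) k
  iterate xs zero    = ev-prec-zero (pz xs)
  iterate xs (suc k) = ev-prec-suc (iterate xs k) (ps _)

toFun₁ : ∀ {G f} → Computable 1 G → (∀ a → G (a ∷ []) ≡ f a) → ComputableFun f
toFun₁ (e , p) eq = e , λ a → subst (e [ a ∷ [] ]⇓_) (eq a) (p (a ∷ []))

toFun₂ : ∀ {G f} → Computable 2 G → (∀ a c → G (a ∷ c ∷ []) ≡ f a c) → Computable₂ f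
toFun₂ (e , p) eq = e , λ a c → subst (e [ a ∷ c ∷ [] ]⇓_) (eq a c) (p (a ∷ c ∷ []))

add-rec : ∀ a c → primRec a (λ r _ → suc r) c ≡ a + c
add-rec a zero    = sym (+-identityʳ a)
add-rec a (suc c) = trans (cong suc (add-rec a c)) (sym (+-suc a c))

mul-rec : ∀ a c → primRec 0 (λ r _ → r + a) c ≡ a * c
mul-rec a zero    = sym (*-zeroʳ a)
mul-rec a (suc c) = trans (cong (_+ a) (mul-rec a c)) (trans (+-comm (a * c) a) (sym (*-suc a c)))

pred-rec : ∀ a → primRec 0 (λ _ j → j) a ≡ pred a
pred-rec zero    = refl
pred-rec (suc a) = refl

monus-rec : ∀ a c → primRec a (λ r _ → pred r) c ≡ a ∸ c
monus-rec a zero    = refl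
monus-rec a (suc c) = trans (cong pred (monus-rec a c)) (pred[m∸n]≡m∸[1+n] a c)

addᶜ : ∀ {n F G} → Computable n F → Computable n G → Computable n (λ xs → F xs + G xs)
addᶜ = apply₂ (toFun₂ (recᶜ #1 #0 (sucᶜ #0)) add-rec)

mulᶜ : ∀ {n F G} → Computable n F → Computable n G → Computable n (λ xs → F xs * G xs)
mulᶜ = apply₂ (toFun₂ (recᶜ #1 (constᶜ 0) (addᶜ #0 (weaken (weaken #0)))) mul-rec)

monusᶜ : ∀ {n F G} → Computable n F → Computable n G → Computable n (λ xs → F xs ∸ G xs)
monusᶜ = apply₂ (toFun₂ (recᶜ #1 #0 (apply₁ (toFun₁ (recᶜ #0 (constᶜ 0) #1) pred-rec) #0)) monus-rec)

-- Truth values are coded by numbers: a number holds when it is nonzero.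
Holds : ℕ → Set
Holds a = a ≢ 0

sg : ℕ → ℕ
sg = primRec 0 (λ _ _ → 1)

isZero : ℕ → ℕ
isZero = primRec 1 (λ _ _ → 0)

equal : ℕ → ℕ → ℕ
equal a c = isZero ((a ∸ c) + (c ∸ a))

implies : ℕ → ℕ → ℕ
implies a c = isZero a + c

sumTo : ℕ → (ℕ → ℕ) → ℕ
sumTo t g = primRec 0 (λ r j → r + g j) t

prodTo : ℕ → (ℕ → ℕ) → ℕ
prodTo t g = primRec 1 (λ r j → r * g j) t

sgᶜ : ∀ {n F} → Computable n F → Computable n (λ xs → sg (F xs))
sgᶜ = apply₁ (toFun₁ (recᶜ #0 (constᶜ 0) (constᶜ 1)) λ _ → refl)

isZeroᶜ : ∀ {n F} → Computable n F → Computable n (λ xs → isZero (F xs))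
isZeroᶜ = apply₁ (toFun₁ (recᶜ #0 (constᶜ 1) (constᶜ 0)) λ _ → refl)

equalᶜ : ∀ {n F G} → Computable n F → Computable n G → Computable n (λ xs → equal (F xs) (G xs))
equalᶜ F G = isZeroᶜ (addᶜ (monusᶜ F G) (monusᶜ G F))

impliesᶜ : ∀ {n F G} → Computable n F → Computable n G → Computable n (λ xs → implies (F xs) (G xs))
impliesᶜ F G = addᶜ (isZeroᶜ F) G

sumᶜ : ∀ {n T B} → Computable n T → Computable (suc n) B →
  Computable n (λ xs → sumTo (T xs) (λ j → B (j ∷ xs)))
sumᶜ T B = recᶜ T (constᶜ 0) (addᶜ #0 (weaken B))

prodᶜ : ∀ {n T B} → Computable n T → Computable (suc n) B →
  Computable n (λ xs → prodTo (T xs) (λ j → B (j ∷ xs)))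
prodᶜ T B = recᶜ T (constᶜ 1) (mulᶜ #0 (weaken B))

sg-bit : ∀ a → sg a ≡ 0 ⊎ sg a ≡ 1
sg-bit zero    = inj₁ refl
sg-bit (suc a) = inj₂ refl

sg-one : ∀ a → Holds (sg a) → sg a ≡ 1
sg-one zero    h = ⊥-elim (h refl)
sg-one (suc a) _ = refl

sg-holds : ∀ a → Holds (sg a) ⇔ Holds a
sg-holds zero    = mk⇔ (λ h → h) (λ h → h)
sg-holds (suc a) = mk⇔ (λ _ ()) (λ _ ())

isZero-holds : ∀ a → Holds (isZero a) ⇔ (a ≡ 0)
isZero-holds zero    = mk⇔ (λ _ → refl) (λ _ ())
isZero-holds (suc a) = mk⇔ (λ h → ⊥-elim (h refl)) (λ ())

isZero-zero : ∀ a → isZero a ≡ 0 ⇔ Holds a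
isZero-zero zero    = mk⇔ (λ ()) (λ h → ⊥-elim (h refl))
isZero-zero (suc a) = mk⇔ (λ _ ()) (λ _ → refl)

*-holds : ∀ a c → Holds (a * c) ⇔ (Holds a × Holds c)
*-holds a c = mk⇔
  (λ h → (λ a≡0 → h (cong (_* c) a≡0)) , (λ c≡0 → h (trans (cong (a *_) c≡0) (*-zeroʳ a))))
  (λ (ha , hc) e → [ ha , hc ]′ (m*n≡0⇒m≡0∨n≡0 a e))

+-holds : ∀ a c → Holds (a + c) ⇔ (Holds a ⊎ Holds c)
+-holds zero    c = mk⇔ inj₂ [ (λ h → ⊥-elim (h refl)) , (λ h → h) ]′
+-holds (suc a) c = mk⇔ (λ _ → inj₁ (λ ())) (λ _ ())

implies-holds : ∀ a c → Holds (implies a c) ⇔ (Holds a → Holds c)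
implies-holds zero    c = mk⇔ (λ _ h → ⊥-elim (h refl)) (λ _ ())
implies-holds (suc a) c = mk⇔ (λ h _ → h) (λ f → f (λ ()))

equal-holds : ∀ a c → Holds (equal a c) ⇔ (a ≡ c)
equal-holds a c = mk⇔ sound (λ { refl → from (isZero-holds _) (cong₂ _+_ (n∸n≡0 a) (n∸n≡0 a)) })
  where
  sound : Holds (equal a c) → a ≡ c
  sound h = ≤-antisym (m∸n≡0⇒m≤n (m+n≡0⇒m≡0 (a ∸ c) both))
                      (m∸n≡0⇒m≤n (m+n≡0⇒n≡0 (a ∸ c) both))
    where both : (a ∸ c) + (c ∸ a) ≡ 0
          both = to (isZero-holds _) h

prod-holds : ∀ t g → Holds (prodTo t g) ⇔ (∀ j → j < t → Holds (g j))
prod-holds zero    g = mk⇔ (λ _ _ ()) (λ _ ())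
prod-holds (suc t) g = mk⇔
  (λ h j j<1+t → let (ht , hg) = to (*-holds (prodTo t g) (g t)) h in
     [ to (prod-holds t g) ht j , (λ { refl → hg }) ]′ (m≤n⇒m<n∨m≡n (≤-pred j<1+t)))
  (λ f → from (*-holds (prodTo t g) (g t))
     (from (prod-holds t g) (λ j j<t → f j (m<n⇒m<1+n j<t)) , f t ≤-refl))

sum-holds : ∀ t g → Holds (sumTo t g) ⇔ (Σ ℕ λ j → j < t × Holds (g j))
sum-holds zero    g = mk⇔ (λ h → ⊥-elim (h refl)) (λ ())
sum-holds (suc t) g = mk⇔
  (λ h → [ (λ ht → let (j , j<t , hj) = to (sum-holds t g) ht in j , m<n⇒m<1+n j<t , hj)
         , (λ hg → t , ≤-refl , hg) ]′ (to (+-holds (sumTo t g) (g t)) h))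
  (λ (j , j<1+t , hj) → from (+-holds (sumTo t g) (g t))
     ([ (λ j<t → inj₁ (from (sum-holds t g) (j , j<t , hj))) , (λ { refl → inj₂ hj }) ]′
        (m≤n⇒m<n∨m≡n (≤-pred j<1+t))))

sum-≥ : ∀ t g j → j < t → g j ≤ sumTo t g
sum-≥ (suc t) g j j<1+t with m≤n⇒m<n∨m≡n (≤-pred j<1+t)
... | inj₁ j<t = ≤-trans (sum-≥ t g j j<t) (m≤m+n (sumTo t g) (g t))
... | inj₂ refl = m≤n+m (g j) (sumTo t g)

-- A set of words is decidable as soon as a computable function holds exactly on
-- the codes of its members: its sign is the characteristic function.
decidableBySign : ∀ {k} {P : Word k → Set} {h : ℕ → ℕ} → ComputableFun h →
  (∀ w → Holds (h (encode w)) ⇔ P w) → DecidableSet P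
decidableBySign {k} {P} {h} ch spec = proj₁ χ , λ w → answer w (sg-bit (h (encode w)))
  where
  χ : ComputableFun (λ m → sg (h m))
  χ = toFun₁ (sgᶜ (apply₁ ch #0)) (λ _ → refl)

  answer : ∀ (w : Word k) → sg (h (encode w)) ≡ 0 ⊎ sg (h (encode w)) ≡ 1 →
    (P w × proj₁ χ [ encode w ∷ [] ]⇓ 1) ⊎ (¬ P w × proj₁ χ [ encode w ∷ [] ]⇓ 0)
  answer w (inj₁ out≡0) = inj₂ ((λ pw → from (sg-holds _) (from (spec w) pw) out≡0)
                              , subst (proj₁ χ [ encode w ∷ [] ]⇓_) out≡0 (proj₂ χ (encode w)))
  answer w (inj₂ out≡1) = inj₁ (to (spec w) (to (sg-holds _) (λ e → 0≢1+n (trans (sym e) out≡1)))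
                              , subst (proj₁ χ [ encode w ∷ [] ]⇓_) out≡1 (proj₂ χ (encode w)))

LeastZero : (ℕ → ℕ) → ℕ → Set
LeastZero g y = g y ≡ 0 × (∀ z → z < y → Holds (g z))

scan : (g : ℕ → ℕ) → ∀ n → Σ ℕ (LeastZero g) ⊎ (∀ z → z < n → Holds (g z))
scan g zero = inj₂ (λ _ ())
scan g (suc n) with scan g n
... | inj₁ found = inj₁ found
... | inj₂ none with g n in gn
...   | zero  = inj₁ (n , gn , none)
...   | suc _ = inj₂ λ z z<1+n →
                  [ none z , (λ { refl gz → 0≢1+n (trans (sym gz) gn) }) ]′ (m<1+n⇒m<n∨m≡n z<1+n)

leastZero : (g : ℕ → ℕ) (y : ℕ) → g y ≡ 0 → Σ ℕ (LeastZero g)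
leastZero g y gy with scan g (suc y)
... | inj₁ found = found
... | inj₂ none  = ⊥-elim (none y ≤-refl gy)

minimiseᶜ : ∀ {G : ℕ → ℕ → ℕ} → Computable₂ G → (root : ∀ n → Σ ℕ λ y → G y n ≡ 0) →
  ComputableFun (λ n → proj₁ (leastZero (λ y → G y n) (proj₁ (root n)) (proj₂ (root n))))
minimiseᶜ {G} (e , pe) root = mu e , λ n →
  let (y , Gy≡0 , below) = leastZero (λ y → G y n) (proj₁ (root n)) (proj₂ (root n))
  in ev-mu (subst (e [ y ∷ n ∷ [] ]⇓_) Gy≡0 (pe y n)) (λ z z<y → positive z n (below z z<y))
  where
  positive : ∀ z n → Holds (G z n) → Σ ℕ λ v → e [ z ∷ n ∷ [] ]⇓ suc v
  positive z n h with G z n | pe z n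
  ... | zero  | _  = ⊥-elim (h refl)
  ... | suc v | ev = v , ev

-- Words over Fin k are coded in base k+1 with digits 1..k, least significant
-- letter first.  Here the digit structure of codes is made primitive recursive.
module WordCoding (k : ℕ) where

  base : ℕ
  base = suc k

  divmod-unique : ∀ {m} r q → r + q * base ≡ m → r < base → m % base ≡ r × m / base ≡ q
  divmod-unique r q refl r<base =
    trans ([m+kn]%n≡m%n r q base) (m<n⇒m%n≡m r<base) ,
    trans (+-distrib-/-∣ʳ r (divides q refl)) (cong₂ _+_ (m<n⇒m/n≡0 r<base) (m*n/n≡m q base))

  -- Remainder and quotient computed by counting upwards with a carry.
  rem : ℕ → ℕ
  rem = primRec 0 (λ r _ → suc r * sg (base ∸ suc r))

  quot : ℕ → ℕ
  quot = primRec 0 (λ q m → q + isZero (base ∸ suc (rem m)))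

  carry : ∀ r q m → r + q * base ≡ m → r < base →
    suc r * sg (base ∸ suc r) + (q + isZero (base ∸ suc r)) * base ≡ suc m × suc r * sg (base ∸ suc r) < base
  carry r q m eq r<base with base ∸ suc r in gap
  ... | zero  = wrap , subst (_< base) (sym (*-zeroʳ (suc r))) z<s
    where
    wrap : suc r * 0 + (q + 1) * base ≡ suc m
    wrap rewrite *-zeroʳ (suc r) | +-comm q 1 =
      trans (cong (_+ q * base) (sym (≤-antisym r<base (m∸n≡0⇒m≤n gap)))) (cong suc eq)
  ... | suc _ =
    trans (cong₂ _+_ (*-identityʳ (suc r)) (cong (_* base) (+-identityʳ q))) (cong suc eq) ,
    subst (_< base) (sym (*-identityʳ (suc r))) (m∸n≢0⇒n<m (λ e → 0≢1+n (trans (sym e) gap)))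

  rem-quot : ∀ m → rem m + quot m * base ≡ m × rem m < base
  rem-quot zero    = refl , z<s
  rem-quot (suc m) = carry (rem m) (quot m) m (proj₁ (rem-quot m)) (proj₂ (rem-quot m))

  rem-quot-correct : ∀ m → m % base ≡ rem m × m / base ≡ quot m
  rem-quot-correct m = let (eq , lt) = rem-quot m in divmod-unique (rem m) (quot m) eq lt

  remᶜ : ComputableFun rem
  remᶜ = toFun₁ (recᶜ #0 (constᶜ 0) (mulᶜ (sucᶜ #0) (sgᶜ (monusᶜ (constᶜ base) (sucᶜ #0)))))
                (λ _ → refl)

  modᶜ : ∀ {n F} → Computable n F → Computable n (λ xs → F xs % base)
  modᶜ = apply₁ (toFun₁ (apply₁ remᶜ #0) (λ m → sym (proj₁ (rem-quot-correct m))))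

  divᶜ : ∀ {n F} → Computable n F → Computable n (λ xs → F xs / base)
  divᶜ = apply₁ (toFun₁ (recᶜ #0 (constᶜ 0)
                           (addᶜ #0 (isZeroᶜ (monusᶜ (constᶜ base) (sucᶜ (apply₁ remᶜ #1))))))
                        (λ m → sym (proj₂ (rem-quot-correct m))))

  shift : ℕ → ℕ → ℕ
  shift j c = primRec c (λ r _ → r / base) j

  digit : ℕ → ℕ → ℕ
  digit j c = shift j c % base

  pow : ℕ → ℕ
  pow = primRec 1 (λ r _ → r * base)

  shiftᶜ : ∀ {n J C} → Computable n J → Computable n C → Computable n (λ xs → shift (J xs) (C xs))
  shiftᶜ J C = recᶜ J C (divᶜ #0)

  digitᶜ : ∀ {n J C} → Computable n J → Computable n C → Computable n (λ xs → digit (J xs) (C xs))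
  digitᶜ J C = modᶜ (shiftᶜ J C)

  powᶜ : ∀ {n L} → Computable n L → Computable n (λ xs → pow (L xs))
  powᶜ L = recᶜ L (constᶜ 1) (mulᶜ #0 (constᶜ base))

  encode-split : ∀ (a : Fin k) u → suc (toℕ a) + encode u * base ≡ encode (a ∷ u)
  encode-split a u = cong (suc (toℕ a) +_) (*-comm (encode u) base)

  encode-%-/ : ∀ (a : Fin k) u → encode (a ∷ u) % base ≡ suc (toℕ a) × encode (a ∷ u) / base ≡ encode u
  encode-%-/ a u = divmod-unique (suc (toℕ a)) (encode u) (encode-split a u) (s≤s (toℕ<n a))

  shift-/ : ∀ j c → shift j c / base ≡ shift j (c / base)
  shift-/ zero    c = refl
  shift-/ (suc j) c = cong (_/ base) (shift-/ j c)

  shift-zero : ∀ j → shift j 0 ≡ 0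
  shift-zero zero    = refl
  shift-zero (suc j) = trans (cong (_/ base) (shift-zero j)) (0/n≡0 base)

  shift-encode : ∀ j (u : Word k) → shift j (encode u) ≡ encode (drop j u)
  shift-encode zero    u       = refl
  shift-encode (suc j) []      = trans (shift-/ j 0) (trans (cong (shift j) (0/n≡0 base)) (shift-zero j))
  shift-encode (suc j) (a ∷ u) =
    trans (shift-/ j (encode (a ∷ u))) (trans (cong (shift j) (proj₂ (encode-%-/ a u))) (shift-encode j u))

  shift-encode-zero : ∀ t (u : Word k) → shift t (encode u) ≡ 0 ⇔ length u ≤ t
  shift-encode-zero t u = mk⇔ (λ e → dropped t u (trans (sym (shift-encode t u)) e))
                               (λ le → trans (shift-encode t u) (cong encode (drop-all t u le)))
    where
    dropped : ∀ t (u : Word k) → encode (drop t u) ≡ 0 → length u ≤ t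
    dropped t       []      _ = z≤n
    dropped (suc t) (a ∷ u) e = s≤s (dropped t u e)

    drop-all : ∀ t (u : Word k) → length u ≤ t → drop t u ≡ []
    drop-all zero    []      _         = refl
    drop-all (suc t) []      _         = refl
    drop-all (suc t) (a ∷ u) (s≤s le) = drop-all t u le

  digit-suc : ∀ j c → digit (suc j) c ≡ digit j (c / base)
  digit-suc j c = cong (_% base) (shift-/ j c)

  digit-cons : ∀ t (a : Fin k) u → digit (suc t) (encode (a ∷ u)) ≡ digit t (encode u)
  digit-cons t a u = trans (digit-suc t (encode (a ∷ u))) (cong (digit t) (proj₂ (encode-%-/ a u)))

  -- Within the length of a word every digit of its code is a letter, hence nonzero.
  digits-positive : ∀ (u : Word k) t → t < length u → Holds (digit t (encode u))
  digits-positive (a ∷ u) zero    _          e = 0≢1+n (trans (sym e) (proj₁ (encode-%-/ a u)))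
  digits-positive (a ∷ u) (suc t) (s≤s t<n) e = digits-positive u t t<n (trans (sym (digit-cons t a u)) e)

  DigitsAt : Seq k → Word k → ℕ → Set
  DigitsAt x w p = ∀ t → t < length w → digit t (encode w) ≡ suc (toℕ (x (p + t)))

  occursAt-digits : (x : Seq k) (w : Word k) (p : ℕ) → OccursAt x w p ⇔ DigitsAt x w p
  occursAt-digits x []      p = mk⇔ (λ _ _ ()) (λ _ → _)
  occursAt-digits x (a ∷ u) p = mk⇔ forward backward
    where
    rest : OccursAt x u (suc p) ⇔ DigitsAt x u (suc p)
    rest = occursAt-digits x u (suc p)

    forward : OccursAt x (a ∷ u) p → DigitsAt x (a ∷ u) p
    forward (xp≡a , occ) zero    _ =
      trans (proj₁ (encode-%-/ a u)) (cong (λ b → suc (toℕ b)) (sym (trans (cong x (+-identityʳ p)) xp≡a)))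
    forward (xp≡a , occ) (suc t) (s≤s t<n) =
      trans (digit-cons t a u) (trans (to rest occ t t<n) (cong (λ i → suc (toℕ (x i))) (sym (+-suc p t))))

    backward : DigitsAt x (a ∷ u) p → OccursAt x (a ∷ u) p
    backward h =
      trans (cong x (sym (+-identityʳ p)))
            (toℕ-injective (suc-injective (trans (sym (h 0 z<s)) (proj₁ (encode-%-/ a u))))) ,
      from rest (λ t t<n → trans (sym (digit-cons t a u))
                                 (trans (h (suc t) (s≤s t<n)) (cong (λ i → suc (toℕ (x i))) (+-suc p t))))

  encode-injective : ∀ (u w : Word k) → encode u ≡ encode w → u ≡ w
  encode-injective []      []      _ = refl
  encode-injective (a ∷ u) (c ∷ w) e =
    cong₂ _∷_ (toℕ-injective (suc-injective same-letter)) (encode-injective u w same-rest)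
    where
    same-letter : suc (toℕ a) ≡ suc (toℕ c)
    same-letter = trans (sym (proj₁ (encode-%-/ a u))) (trans (cong (_% base) e) (proj₁ (encode-%-/ c w)))

    same-rest : encode u ≡ encode w
    same-rest = trans (sym (proj₂ (encode-%-/ a u))) (trans (cong (_/ base) e) (proj₂ (encode-%-/ c w)))

  length≤encode : ∀ (u : Word k) → length u ≤ encode u
  length≤encode []      = z≤n
  length≤encode (a ∷ u) =
    s≤s (≤-trans (length≤encode u) (≤-trans (m≤n*m (encode u) base) (m≤n+m (base * encode u) (toℕ a))))

  encode<pow : ∀ (u : Word k) → encode u < pow (length u)
  encode<pow []      = z<s
  encode<pow (a ∷ u) = begin-strict
      suc (toℕ a) + base * encode u   <⟨ +-monoˡ-< (base * encode u) (s≤s (toℕ<n a)) ⟩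
      base + base * encode u          ≡⟨ sym (*-suc base (encode u)) ⟩
      base * suc (encode u)           ≤⟨ *-monoʳ-≤ base (encode<pow u) ⟩
      base * pow (length u)           ≡⟨ *-comm base _ ⟩
      pow (length u) * base           ∎
    where open ≤-Reasoning

  decode : ∀ L c → (∀ j → j < L → Holds (digit j c)) → shift L c ≡ 0 →
    Σ (Word k) λ w → length w ≡ L × encode w ≡ c
  decode zero    c _      c≡0 = [] , refl , sym c≡0
  decode (suc L) c digits end =
    let (a , a≡r) = letter (c % base) (digits 0 z<s) (m%n<n c base)
        (w , lw , ew) = decode L (c / base)
                          (λ j j<L → subst Holds (digit-suc j c) (digits (suc j) (s≤s j<L)))
                          (trans (sym (shift-/ L c)) end)
    in a ∷ w , cong suc lw ,
       (begin
          encode (a ∷ w)                       ≡⟨ sym (encode-split a w) ⟩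
          suc (toℕ a) + encode w * base        ≡⟨ cong₂ (λ r q → r + q * base) a≡r ew ⟩
          c % base + (c / base) * base         ≡⟨ sym (m≡m%n+[m/n]*n c base) ⟩
          c                                    ∎)
    where
    open ≡-Reasoning
    letter : ∀ r → Holds r → r < base → Σ (Fin k) λ a → suc (toℕ a) ≡ r
    letter zero    r≢0 _          = ⊥-elim (r≢0 refl)
    letter (suc r) _   (s≤s r<k) = fromℕ< r<k , cong suc (toℕ-fromℕ< r<k)

  valid : ℕ → ℕ → ℕ
  valid L c = sg (prodTo L (λ j → digit j c) * isZero (shift L c))

  validᶜ : ∀ {n L C} → Computable n L → Computable n C → Computable n (λ xs → valid (L xs) (C xs))
  validᶜ L C = sgᶜ (mulᶜ (prodᶜ L (digitᶜ #0 (weaken C))) (isZeroᶜ (shiftᶜ L C)))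

  valid-bit : ∀ L c → valid L c ≡ 0 ⊎ valid L c ≡ 1
  valid-bit L c = sg-bit (prodTo L (λ j → digit j c) * isZero (shift L c))

  valid-one : ∀ L c → Holds (valid L c) → valid L c ≡ 1
  valid-one L c = sg-one (prodTo L (λ j → digit j c) * isZero (shift L c))

  valid-holds : ∀ L c → Holds (valid L c) ⇔ (Σ (Word k) λ w → length w ≡ L × encode w ≡ c)
  valid-holds L c = mk⇔ sound complete
    where
    sound : Holds (valid L c) → Σ (Word k) λ w → length w ≡ L × encode w ≡ c
    sound h = let (digits , end) = to (*-holds _ _) (to (sg-holds _) h) in
              decode L c (to (prod-holds L _) digits) (to (isZero-holds _) end)

    complete : (Σ (Word k) λ w → length w ≡ L × encode w ≡ c) → Holds (valid L c)
    complete (w , refl , refl) = from (sg-holds _) (from (*-holds _ _)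
      (from (prod-holds L _) (digits-positive w) , from (isZero-holds _) (from (shift-encode-zero L w) ≤-refl)))

  -- Quantifying over all words of length L is a bounded quantifier over codes.
  forallWords : ∀ L (g : ℕ → ℕ) →
    Holds (prodTo (pow L) (λ c → implies (valid L c) (g c))) ⇔ (∀ w → length w ≡ L → Holds (g (encode w)))
  forallWords L g = mk⇔
    (λ h w → λ { refl → to (implies-holds _ _) (to (prod-holds (pow L) _) h (encode w) (encode<pow w))
                                                (from (valid-holds L (encode w)) (w , refl , refl)) })
    (λ f → from (prod-holds (pow L) _) λ c _ → from (implies-holds _ _) λ hv →
       let (w , lw , ew) = to (valid-holds L c) hv in subst (Holds ∘ g) ew (f w lw))

recurrent : ∀ {k} {x : Seq k} → AlmostPeriodic x → ∀ u → Fac x u → InfinitelyOften x u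
recurrent ap u fu m = let (l , every) = ap u fu ; (j , m≤j , _ , occ) = every m in j , m≤j , occ

finiteMax : ∀ {k} (g : Fin k → ℕ) → Σ ℕ λ L → ∀ a → g a ≤ L
finiteMax {zero}  g = 0 , λ ()
finiteMax {suc k} g =
  let (L , L≥) = finiteMax (g ∘ fs)
  in g fz ⊔ L , λ { fz → m≤m⊔n (g fz) L ; (fs a) → ≤-trans (L≥ a) (m≤n⊔m (g fz) L) }

-- There are finitely many words of each length: if every word with the decidable
-- property P has a threshold from which the upward closed property Q holds, then
-- one threshold serves all words of length n with property P.
commonThreshold : ∀ {k} (P : Word k → Set) (Q : Word k → ℕ → Set) → (∀ u → Dec (P u)) →
  (∀ u {l l'} → l ≤ l' → Q u l → Q u l') → (∀ u → P u → Σ ℕ (Q u)) →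
  ∀ n → Σ ℕ λ L → ∀ u → length u ≡ n → P u → Q u L
commonThreshold P Q P? mono threshold zero with P? []
... | yes p  = proj₁ (threshold [] p) , λ { [] refl _ → proj₂ (threshold [] p) }
... | no  ¬p = 0 , λ { [] refl p → ⊥-elim (¬p p) }
commonThreshold P Q P? mono threshold (suc n) =
  let (L , L≥) = finiteMax (proj₁ ∘ extending)
  in L , λ { (a ∷ u) lu pu → mono (a ∷ u) (L≥ a) (proj₂ (extending a) u (suc-injective lu) pu) }
  where
  extending : ∀ a → Σ ℕ λ L → ∀ u → length u ≡ n → P (a ∷ u) → Q (a ∷ u) L
  extending a =
    commonThreshold (P ∘ (a ∷_)) (Q ∘ (a ∷_)) (P? ∘ (a ∷_)) (mono ∘ (a ∷_)) (threshold ∘ (a ∷_)) n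

everySegment-mono : ∀ {k} {x : Seq k} u {l l'} → l ≤ l' → InEverySegment x u l → InEverySegment x u l'
everySegment-mono u l≤l' every i =
  let (j , i≤j , end , occ) = every i in j , i≤j , ≤-trans end (+-monoʳ-≤ i l≤l') , occ

Covers : ∀ {k} → Seq k → ℕ → ℕ → Set
Covers x n L = ∀ u → length u ≡ n → Fac x u → InEverySegment x u L

-- For almost periodic x no factor is rare, so a covering length bounds the regulator.
covering⇒regulator : ∀ {k} {x : Seq k} → AlmostPeriodic x → ∀ n L → Covers x n L → RegulatorCondition x n L
covering⇒regulator ap n L cov =
  (λ u lu fu _ → cov u lu fu) , (λ u _ (fu , rare) _ _ _ → ⊥-elim (rare (recurrent ap u fu)))

window : ∀ {k} → Seq k → ℕ → ℕ → Word k
window x i zero    = []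
window x i (suc L) = x i ∷ window x (suc i) L

window-occurs : ∀ {k} (x : Seq k) i L → OccursAt x (window x i L) i
window-occurs x i zero    = _
window-occurs x i (suc L) = refl , window-occurs x (suc i) L

window-length : ∀ {k} (x : Seq k) i L → length (window x i L) ≡ L
window-length x i zero    = refl
window-length x i (suc L) = cong suc (window-length x (suc i) L)

module Occurrences {k} (x : Seq k) (cx : ComputableSeq x) where
  open WordCoding k

  -- Every digit position t < m of the code m lies beyond the word or carries x(i+t).
  occurrenceTest : ℕ → ℕ → ℕ
  occurrenceTest m i = prodTo m (λ t → isZero (shift t m) + equal (digit t m) (suc (toℕ (x (i + t)))))

  occurrenceᶜ : ∀ {n M I} → Computable n M → Computable n I → Computable n (λ xs → occurrenceTest (M xs) (I xs))
  occurrenceᶜ M I = prodᶜ M (addᶜ (isZeroᶜ (shiftᶜ #0 (weaken M)))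
                                  (equalᶜ (digitᶜ #0 (weaken M)) (sucᶜ (apply₁ cx (addᶜ (weaken I) #0)))))

  occurrenceTest-holds : ∀ (w : Word k) i → Holds (occurrenceTest (encode w) i) ⇔ OccursAt x w i
  occurrenceTest-holds w i = mk⇔
    (λ h → from (occursAt-digits x w i) λ t t<n →
      [ (λ beyond → ⊥-elim (<⇒≱ t<n (to (shift-encode-zero t w) (to (isZero-holds _) beyond))))
      , to (equal-holds _ _) ]′
      (to (+-holds _ _) (to (prod-holds (encode w) _) h t (<-≤-trans t<n (length≤encode w)))))
    (λ occ → from (prod-holds (encode w) _) λ t _ → from (+-holds _ _) (position t occ))
    where
    position : ∀ t → OccursAt x w i →
      Holds (isZero (shift t (encode w))) ⊎ Holds (equal (digit t (encode w)) (suc (toℕ (x (i + t)))))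
    position t occ with t <? length w
    ... | yes t<n = inj₂ (from (equal-holds _ _) (to (occursAt-digits x w i) occ t t<n))
    ... | no  t≮n = inj₁ (from (isZero-holds _) (from (shift-encode-zero t w) (≮⇒≥ t≮n)))

-- Forward direction: with a computable bound f on the regulator, a factor w occurs
-- in the initial segment of length f(|w|), and f(|w|) ≤ f(0)+…+f(m) for the code
-- m of w, so membership in Fac(x) is a bounded search.
module Forward {k} (x : Seq k) (ap : AlmostPeriodic x) (cx : ComputableSeq x)
               (f : ℕ → ℕ) (cf : ComputableFun f) (reg : ∀ n → RegulatorCondition x n (f n)) where
  open WordCoding k
  open Occurrences x cx

  earlyOccurrence : ∀ w → Fac x w → Σ ℕ λ i → i < f (length w) × OccursAt x w i
  earlyOccurrence w fw@(w≢[] , _) =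
    let (j , _ , j+n≤f , occ) = proj₁ (reg (length w)) w refl fw (recurrent ap w fw) 0
    in j , <-≤-trans (m<m+n j (nonempty w w≢[])) j+n≤f , occ
    where
    nonempty : ∀ (w : Word k) → w ≢ [] → 0 < length w
    nonempty []      w≢[] = ⊥-elim (w≢[] refl)
    nonempty (_ ∷ _) _    = z<s

  factorTest : ℕ → ℕ
  factorTest m = m * sumTo (sumTo (suc m) f) (occurrenceTest m)

  factorTest-holds : ∀ w → Holds (factorTest (encode w)) ⇔ Fac x w
  factorTest-holds w = mk⇔
    (λ h → let (code≢0 , found) = to (*-holds m _) h
               (i , _ , occ) = to (sum-holds bound _) found
           in (λ { refl → code≢0 refl }) , i , to (occurrenceTest-holds w i) occ)
    (λ fw@(w≢[] , _) → let (i , i<f , occ) = earlyOccurrence w fw in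
       from (*-holds m _) (code≢0 w w≢[] , from (sum-holds bound (occurrenceTest m))
         (i , <-≤-trans i<f (sum-≥ (suc m) f (length w) (s≤s (length≤encode w)))
            , from (occurrenceTest-holds w i) occ)))
    where
    m bound : ℕ
    m = encode w
    bound = sumTo (suc m) f

    code≢0 : ∀ (w : Word k) → w ≢ [] → Holds (encode w)
    code≢0 []      w≢[] = ⊥-elim (w≢[] refl)
    code≢0 (_ ∷ _) _    = λ ()

  factorsDecidable : DecidableSet (Fac x)
  factorsDecidable = decidableBySign
    (toFun₁ (mulᶜ #0 (sumᶜ (sumᶜ (sucᶜ #0) (apply₁ cf #0)) (occurrenceᶜ (weaken #0) #0))) (λ _ → refl))
    factorTest-holds

-- Backward direction: with Fac(x) decidable, "every factor of length n occurs in
-- every factor of length L" is a bounded quantification over codes, hence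
-- decidable; for L > 0 it says that L is a covering length.  The least positive
-- covering length is found by unbounded search, which terminates because almost
-- periodicity provides some covering length.
module Backward {k} (x : Seq k) (ap : AlmostPeriodic x) (cx : ComputableSeq x) (dec : DecidableSet (Fac x)) where
  open WordCoding k

  decider : Code 1
  decider = proj₁ dec

  factor? : ∀ w → Dec (Fac x w)
  factor? w = [ (λ (fw , _) → yes fw) , (λ (¬fw , _) → no ¬fw) ]′ (proj₂ dec w)

  answer : Word k → ℕ
  answer w = [ (λ _ → 1) , (λ _ → 0) ]′ (proj₂ dec w)

  answer-⇓ : ∀ w → decider [ encode w ∷ [] ]⇓ answer w
  answer-⇓ w with proj₂ dec w
  ... | inj₁ (_ , ev) = ev
  ... | inj₂ (_ , ev) = ev

  answer-holds : ∀ w → Holds (answer w) ⇔ Fac x w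
  answer-holds w with proj₂ dec w
  ... | inj₁ (fw , _)  = mk⇔ (λ _ → fw) (λ _ ())
  ... | inj₂ (¬fw , _) = mk⇔ (λ h → ⊥-elim (h refl)) (λ fw → ⊥-elim (¬fw fw))

  -- The decider is only specified on codes of words, so an arbitrary c is first
  -- replaced by 0 (the code of the empty word) unless it codes a word of length L.
  sanitise : ℕ → ℕ → ℕ
  sanitise L c = valid L c * c

  sanitised : ∀ L c → Σ (Word k) λ w → encode w ≡ sanitise L c
  sanitised L c with valid-bit L c
  ... | inj₁ invalid = [] , cong (_* c) (sym invalid)
  ... | inj₂ valid≡1 = let (w , _ , ew) = to (valid-holds L c) (λ e → 0≢1+n (trans (sym e) valid≡1))
                       in w , trans ew (sym (trans (cong (_* c) valid≡1) (+-identityʳ c)))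

  sanitise-encode : ∀ w → proj₁ (sanitised (length w) (encode w)) ≡ w
  sanitise-encode w = encode-injective _ w (trans (proj₂ (sanitised (length w) (encode w)))
    (trans (cong (_* encode w) (valid-one (length w) (encode w) w-valid)) (+-identityʳ (encode w))))
    where
    w-valid : Holds (valid (length w) (encode w))
    w-valid = from (valid-holds (length w) (encode w)) (w , refl , refl)

  factorTest : ℕ → ℕ → ℕ
  factorTest L c = answer (proj₁ (sanitised L c))

  factorTest-holds : ∀ L w → length w ≡ L → Holds (factorTest L (encode w)) ⇔ Fac x w
  factorTest-holds _ w refl = subst (λ v → Holds (answer v) ⇔ Fac x w) (sym (sanitise-encode w)) (answer-holds w)

  factorTestᶜ : ∀ {n L C} → Computable n L → Computable n C → Computable n (λ xs → factorTest (L xs) (C xs))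
  factorTestᶜ = apply₂ (comp decider (proj₁ sanitiseᶜ ∷ []) , λ L c →
    ev-comp (ev-∷ (proj₂ sanitiseᶜ (L ∷ c ∷ [])) ev-[])
            (subst (λ m → decider [ m ∷ [] ]⇓ factorTest L c) (proj₂ (sanitised L c)) (answer-⇓ _)))
    where
    sanitiseᶜ : Computable 2 (λ xs → sanitise (lookupV xs fz) (lookupV xs (fs fz)))
    sanitiseᶜ = mulᶜ (validᶜ #0 #1) #1

  -- containsTest n L c d: the word coded by d (length n) appears at some offset
  -- i ≤ L - n inside the word coded by c (length L).
  containsTest : ℕ → ℕ → ℕ → ℕ → ℕ
  containsTest n L c d =
    sumTo (suc L) (λ i → isZero ((i + n) ∸ L) * prodTo n (λ t → equal (digit (i + t) c) (digit t d)))

  containsᶜ : ∀ {m N L C D} → Computable m N → Computable m L → Computable m C → Computable m D →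
    Computable m (λ xs → containsTest (N xs) (L xs) (C xs) (D xs))
  containsᶜ N L C D =
    sumᶜ (sucᶜ L) (mulᶜ (isZeroᶜ (monusᶜ (addᶜ #0 (weaken N)) (weaken L)))
                        (prodᶜ (weaken N) (equalᶜ (digitᶜ (addᶜ #1 #0) (weaken (weaken C)))
                                                 (digitᶜ #0 (weaken (weaken D))))))

  containsTest-holds : ∀ n L (w u : Word k) p → length u ≡ n → length w ≡ L → OccursAt x w p →
    Holds (containsTest n L (encode w) (encode u)) ⇔ OccursInSegment x u p L
  containsTest-holds _ _ w u p refl refl occ-w = mk⇔ sound complete
    where
    n L : ℕ
    n = length u
    L = length w

    letter-w : ∀ i t → i + t < L → digit (i + t) (encode w) ≡ suc (toℕ (x ((p + i) + t)))
    letter-w i t i+t<L = trans (to (occursAt-digits x w p) occ-w (i + t) i+t<L)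
                               (cong (λ j → suc (toℕ (x j))) (sym (+-assoc p i t)))

    sound : Holds (containsTest n L (encode w) (encode u)) → OccursInSegment x u p L
    sound h =
      let (i , _ , hi) = to (sum-holds (suc L) _) h
          (fits , agree) = to (*-holds _ _) hi
          i+n≤L = m∸n≡0⇒m≤n (to (isZero-holds _) fits)
          occ-u = from (occursAt-digits x u (p + i)) λ t t<n →
                    trans (sym (to (equal-holds _ _) (to (prod-holds n _) agree t t<n)))
                          (letter-w i t (<-≤-trans (+-monoʳ-< i t<n) i+n≤L))
      in p + i , m≤m+n p i , subst (_≤ p + L) (sym (+-assoc p i n)) (+-monoʳ-≤ p i+n≤L) , occ-u

    complete : OccursInSegment x u p L → Holds (containsTest n L (encode w) (encode u))
    complete (j , p≤j , j+n≤p+L , occ-u) =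
      from (sum-holds (suc L) _) (i , s≤s (≤-trans (m≤m+n i n) i+n≤L) , from (*-holds _ _)
        (from (isZero-holds _) (m≤n⇒m∸n≡0 i+n≤L) , from (prod-holds n _) λ t t<n → from (equal-holds _ _)
          (trans (letter-w i t (<-≤-trans (+-monoʳ-< i t<n) i+n≤L))
                 (trans (cong (λ j → suc (toℕ (x (j + t)))) p+i≡j) (sym (to (occursAt-digits x u j) occ-u t t<n))))))
      where
      i : ℕ
      i = j ∸ p
      p+i≡j : p + i ≡ j
      p+i≡j = m+[n∸m]≡n p≤j
      i+n≤L : i + n ≤ L
      i+n≤L = +-cancelˡ-≤ p _ _ (subst (_≤ p + L) (trans (cong (_+ n) (sym p+i≡j)) (+-assoc p i n)) j+n≤p+L)

  coverTest : ℕ → ℕ → ℕ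
  coverTest n L = prodTo (pow L) λ c → implies (valid L c) (implies (factorTest L c)
                    (prodTo (pow n) λ d → implies (valid n d) (implies (factorTest n d) (containsTest n L c d))))

  coverᶜ : ∀ {m N L} → Computable m N → Computable m L → Computable m (λ xs → coverTest (N xs) (L xs))
  coverᶜ N L =
    prodᶜ (powᶜ L) (impliesᶜ (validᶜ (weaken L) #0) (impliesᶜ (factorTestᶜ (weaken L) #0)
      (prodᶜ (powᶜ (weaken N)) (impliesᶜ (validᶜ (weaken (weaken N)) #0)
        (impliesᶜ (factorTestᶜ (weaken (weaken N)) #0) (containsᶜ (weaken (weaken N)) (weaken (weaken L)) #1 #0))))))

  -- Every segment of positive length is a factor, so coverTest decides Covers.
  coverTest-holds : ∀ n L → 0 < L → Holds (coverTest n L) ⇔ Covers x n L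
  coverTest-holds n L 0<L = mk⇔ sound complete
    where
    sound : Holds (coverTest n L) → Covers x n L
    sound h u lu fu i =
      let w = window x i L
          lw = window-length x i L
          fw = (λ w≡[] → <⇒≢ 0<L (trans (sym (cong length w≡[])) lw)) , i , window-occurs x i L
          factors-in-w = to (implies-holds _ _) (to (forallWords L _) h w lw) (from (factorTest-holds L w lw) fw)
          u-in-w = to (implies-holds _ _) (to (forallWords n _) factors-in-w u lu) (from (factorTest-holds n u lu) fu)
      in to (containsTest-holds n L w u i lu lw (window-occurs x i L)) u-in-w

    complete : Covers x n L → Holds (coverTest n L)
    complete cov = from (forallWords L _) λ w lw → from (implies-holds _ _) λ hw →
      let (_ , p , occ-w) = to (factorTest-holds L w lw) hw in
      from (forallWords n _) λ u lu → from (implies-holds _ _) λ hu →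
        from (containsTest-holds n L w u p lu lw occ-w) (cov u lu (to (factorTest-holds n u lu) hu) p)

  -- Almost periodicity bounds the gaps of each of the finitely many factors of length n.
  coveringLength : ∀ n → Σ ℕ (Covers x n)
  coveringLength = commonThreshold (Fac x) (InEverySegment x) factor? everySegment-mono ap

  -- search l n vanishes exactly when l+1 is a covering length for n.
  search : ℕ → ℕ → ℕ
  search l n = isZero (coverTest n (suc l))

  searchᶜ : Computable₂ search
  searchᶜ = toFun₂ (isZeroᶜ (coverᶜ #1 (sucᶜ #0))) (λ _ _ → refl)

  search-root : ∀ n → Σ ℕ λ l → search l n ≡ 0
  search-root n =
    let (L , cov) = coveringLength n in
    L , from (isZero-zero _) (from (coverTest-holds n (suc L) z<s)
                                  λ u lu fu → everySegment-mono u (n≤1+n L) (cov u lu fu))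

  firstRoot : ∀ n → Σ ℕ (LeastZero (λ l → search l n))
  firstRoot n = leastZero (λ l → search l n) (proj₁ (search-root n)) (proj₂ (search-root n))

  regulator : ℕ → ℕ
  regulator n = suc (proj₁ (firstRoot n))

  regulatorᶜ : ComputableFun regulator
  regulatorᶜ = toFun₁ (sucᶜ (apply₁ (minimiseᶜ searchᶜ search-root) #0)) (λ _ → refl)

  regulator-covers : ∀ n → Covers x n (regulator n)
  regulator-covers n = to (coverTest-holds n (regulator n) z<s) (to (isZero-zero _) (proj₁ (proj₂ (firstRoot n))))

  effective : EffectivelyAlmostPeriodic x
  effective = ap , cx , regulator , regulatorᶜ , λ n → covering⇒regulator ap n (regulator n) (regulator-covers n)

proposition3 : ∀ {k : ℕ} (x : ℕ → Fin k) → AlmostPeriodic x →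
    EffectivelyAlmostPeriodic x ⇔ (ComputableSeq x × DecidableSet (Fac x))
proposition3 x ap = mk⇔
  (λ (_ , cx , f , cf , reg) → cx , Forward.factorsDecidable x ap cx f cf reg)
  (λ (cx , dec) → Backward.effective x ap cx dec)
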